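{- Let $L\in\mathbb{Z}^{n\times n}$ be a Z-matrix with positive diagonal entries. Let $c\in\mathbb{Z}^n$ be stable, and suppose $c=g-\sum_{j=1}^kLe_{i_j}$ for some $g\in\mathbb{Z}^n$ and $i_1,\dots,i_k\in\{1,\dots,n\}$. Assume that $g^\ell_{i_{\ell+1}}\ge L_{i_{\ell+1}i_{\ell+1}}$ for $\ell=0,1,\dots,k-1$, where $g^\ell=g-\sum_{j=1}^\ell Le_{i_j}$ (so $g^0=g$). If $w\in\mathbb{Z}^n$ with $w\ge0$ is such that $g-Lw$ is stable, then $w\ge z$, where $z=\sum_{j=1}^k e_{i_j}$.
   Context: A Z-matrix is a real square matrix with $L_{ij}\le0$ for $i\ne j$. $e_i$ denotes the $i$-th standard basis vector. A vector $f\in\mathbb{Z}^n$ is stable if $f_i<L_{ii}$ for all $i$. Vector inequalities are entrywise. -}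

module Defs where

open import Data.Nat using (ℕ; zero; suc)
open import Data.Fin using (Fin; toℕ) renaming (zero to fzero; suc to fsuc)
open import Data.Fin.Properties using (_≟_)
open import Data.Integer using (ℤ; _+_; _-_; _≤_; _<_; _*_; +_; 0ℤ)
open import Data.List using (List; []; _∷_; take; length; lookup)
open import Relation.Nullary using (yes; no)
open import Relation.Binary.PropositionalEquality using (_≢_)

Matrix : ℕ → Set
Matrix n = Fin n → Fin n → ℤ

Vector : ℕ → Set
Vector n = Fin n → ℤ

IsZMatrix : ∀ {n} → Matrix n → Set
IsZMatrix {n} L = ∀ (i j : Fin n) → i ≢ j → L i j ≤ 0ℤ

PositiveDiagonal : ∀ {n} → Matrix n → Set
PositiveDiagonal {n} L = ∀ (i : Fin n) → 0ℤ < L i i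

Stable : ∀ {n} → Matrix n → Vector n → Set
Stable {n} L f = ∀ (i : Fin n) → f i < L i i

e : ∀ {n} → Fin n → Vector n
e i r with r ≟ i
... | yes _ = + 1
... | no _ = 0ℤ

_+ᵛ_ : ∀ {n} → Vector n → Vector n → Vector n
(u +ᵛ v) r = u r + v r

_-ᵛ_ : ∀ {n} → Vector n → Vector n → Vector n
(u -ᵛ v) r = u r - v r

zeroᵛ : ∀ {n} → Vector n
zeroᵛ _ = 0ℤ

sumFin : ∀ {n} → (Fin n → ℤ) → ℤ
sumFin {zero} f = 0ℤ
sumFin {suc n} f = f fzero + sumFin (λ r → f (fsuc r))

_·ᵛ_ : ∀ {n} → Matrix n → Vector n → Vector n
(L ·ᵛ v) r = sumFin (λ s → L r s * v s)

sumE : ∀ {n} → List (Fin n) → Vector n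
sumE [] = zeroᵛ
sumE (i ∷ is) = e i +ᵛ sumE is

subCols : ∀ {n} → Matrix n → Vector n → List (Fin n) → Vector n
subCols L g [] = g
subCols L g (i ∷ is) = subCols L g is -ᵛ (L ·ᵛ e i)

_≤ᵛ_ : ∀ {n} → Vector n → Vector n → Set
_≤ᵛ_ {n} u v = ∀ (r : Fin n) → u r ≤ v r

-- Read g as a chip configuration and
-- subtracting L e_i as firing vertex i; the hypothesis says that i₁, …, i_k is a legal
-- firing sequence.  If vertex i is unstable in g (L_ii ≤ g_i), every stabilising firing
-- vector w ≥ 0 fires it: were w_i = 0, the Z-matrix signs would give (g − L w)_i ≥ g_i,
-- so g − L w would still be unstable at i.  Hence w − e_i ≥ 0 stabilises g − L e_i, and
-- induction along the sequence gives Σ_j e_{i_j} ≤ w.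
module Submission where

open import Defs
open import Data.Nat using (ℕ; zero; suc)
open import Data.Fin using (Fin; toℕ) renaming (zero to fzero; suc to fsuc)
open import Data.Fin.Properties using (_≟_)
open import Data.Integer using (ℤ; _≤_; _<_; _+_; _-_; _*_; +_; 0ℤ; _<?_; nonPositive)
open import Data.Integer.Properties
  using (+-mono-≤; +-monoʳ-≤; *-monoˡ-≤-nonPos; *-zeroʳ; +-identityʳ; ≤-reflexive; ≤-trans;
         ≤-antisym; ≤-<-trans; <-irrefl; ≮⇒≥; i<j⇒suc[i]≤j; i≤j⇒0≤j-i; neg-mono-≤)
open import Data.Integer.Tactic.RingSolver using (solve-∀)
open import Data.List using (List; []; _∷_; take; length; lookup)
open import Data.Empty using (⊥-elim)
open import Relation.Nullary using (yes; no)
open import Relation.Binary.PropositionalEquality using (_≡_; refl; sym; trans; cong; cong₂; subst)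

sumFin-cong : ∀ {n} {f h : Fin n → ℤ} → (∀ s → f s ≡ h s) → sumFin f ≡ sumFin h
sumFin-cong {zero}  eq = refl
sumFin-cong {suc n} eq = cong₂ _+_ (eq fzero) (sumFin-cong (λ s → eq (fsuc s)))

sumFin-distrib-- : ∀ {n} (f h : Fin n → ℤ) → sumFin (λ s → f s - h s) ≡ sumFin f - sumFin h
sumFin-distrib-- {zero}  f h = refl
sumFin-distrib-- {suc n} f h =
  trans (cong (_+_ (f fzero - h fzero)) (sumFin-distrib-- (λ s → f (fsuc s)) (λ s → h (fsuc s))))
        (interchange (f fzero) (h fzero) _ _)
  where
  interchange : ∀ (a b c d : ℤ) → (a - b) + (c - d) ≡ (a + c) - (b + d)
  interchange = solve-∀

sumFin-nonPos : ∀ {n} {f : Fin n → ℤ} → (∀ s → f s ≤ 0ℤ) → sumFin f ≤ 0ℤ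
sumFin-nonPos {zero}  f≤0 = ≤-reflexive refl
sumFin-nonPos {suc n} f≤0 = +-mono-≤ (f≤0 fzero) (sumFin-nonPos (λ s → f≤0 (fsuc s)))

-ᵛe-nonNeg : ∀ {n} {w : Vector n} {i} → + 1 ≤ w i → zeroᵛ ≤ᵛ w → zeroᵛ ≤ᵛ (w -ᵛ e i)
-ᵛe-nonNeg {w = w} {i} wᵢ≥1 w≥0 r with r ≟ i
... | yes refl = i≤j⇒0≤j-i wᵢ≥1
... | no  _    = subst (0ℤ ≤_) (sym (+-identityʳ (w r))) (w≥0 r)

module _ {n : ℕ} (L : Matrix n) where

  ·ᵛ-distrib-ᵛ : ∀ (u v : Vector n) r → (L ·ᵛ (u -ᵛ v)) r ≡ (L ·ᵛ u) r - (L ·ᵛ v) r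
  ·ᵛ-distrib-ᵛ u v r =
    trans (sumFin-cong (λ s → *-distribˡ-- (L r s) (u s) (v s)))
          (sumFin-distrib-- (λ s → L r s * u s) (λ s → L r s * v s))
    where
    *-distribˡ-- : ∀ (a x y : ℤ) → a * (x - y) ≡ a * x - a * y
    *-distribˡ-- = solve-∀

  subCols-shift : ∀ (g v : Vector n) (xs : List (Fin n)) r →
                  subCols L (g -ᵛ v) xs r ≡ subCols L g xs r - v r
  subCols-shift g v []       r = refl
  subCols-shift g v (i ∷ xs) r =
    trans (cong (_- (L ·ᵛ e i) r) (subCols-shift g v xs r))
          (swap-subtrahends (subCols L g xs r) (v r) ((L ·ᵛ e i) r))
    where
    swap-subtrahends : ∀ (a b c : ℤ) → (a - b) - c ≡ (a - c) - b
    swap-subtrahends = solve-∀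

  firing-split : ∀ (g w : Vector n) i r →
                 ((g -ᵛ (L ·ᵛ e i)) -ᵛ (L ·ᵛ (w -ᵛ e i))) r ≡ (g -ᵛ (L ·ᵛ w)) r
  firing-split g w i r =
    trans (cong ((g -ᵛ (L ·ᵛ e i)) r -_) (·ᵛ-distrib-ᵛ w (e i) r))
          (cancel (g r) ((L ·ᵛ e i) r) ((L ·ᵛ w) r))
    where
    cancel : ∀ (a b c : ℤ) → (a - b) - (c - b) ≡ a - c
    cancel = solve-∀

  LegalSequence : Vector n → List (Fin n) → Set
  LegalSequence g is = ∀ (ℓ : Fin (length is)) →
    L (lookup is ℓ) (lookup is ℓ) ≤ subCols L g (take (toℕ ℓ) is) (lookup is ℓ)

  legal-tail : ∀ {g i is} → LegalSequence g (i ∷ is) → LegalSequence (g -ᵛ (L ·ᵛ e i)) is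
  legal-tail {g} {i} {is} legal ℓ =
    subst (L (lookup is ℓ) (lookup is ℓ) ≤_)
          (sym (subCols-shift g (L ·ᵛ e i) (take (toℕ ℓ) is) (lookup is ℓ)))
          (legal (fsuc ℓ))

  module _ (Z : IsZMatrix L) where

    ·ᵛ-nonPos : ∀ {w : Vector n} {i} → zeroᵛ ≤ᵛ w → w i ≡ 0ℤ → (L ·ᵛ w) i ≤ 0ℤ
    ·ᵛ-nonPos {w} {i} w≥0 wᵢ≡0 = sumFin-nonPos term≤0
      where
      term≤0 : ∀ s → L i s * w s ≤ 0ℤ
      term≤0 s with s ≟ i
      ... | yes refl = ≤-reflexive (trans (cong (L i i *_) wᵢ≡0) (*-zeroʳ (L i i)))
      ... | no s≢i   = subst (L i s * w s ≤_) (*-zeroʳ (L i s))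
                         (*-monoˡ-≤-nonPos (L i s) {{nonPositive (Z i s (λ i≡s → s≢i (sym i≡s)))}} (w≥0 s))

    unstable⇒fired : ∀ {g w : Vector n} {i} → L i i ≤ g i → zeroᵛ ≤ᵛ w →
                     Stable L (g -ᵛ (L ·ᵛ w)) → + 1 ≤ w i
    unstable⇒fired {g} {w} {i} unstable w≥0 stable with 0ℤ <? w i
    ... | yes wᵢ>0 = i<j⇒suc[i]≤j wᵢ>0
    ... | no  wᵢ≯0 = ⊥-elim (<-irrefl refl (≤-<-trans (≤-trans unstable gᵢ≤) (stable i)))
      where
      gᵢ≤ : g i ≤ g i - (L ·ᵛ w) i
      gᵢ≤ = subst (_≤ g i - (L ·ᵛ w) i) (+-identityʳ (g i))
              (+-monoʳ-≤ (g i) (neg-mono-≤ (·ᵛ-nonPos w≥0 (≤-antisym (≮⇒≥ wᵢ≯0) (w≥0 i)))))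

    legal⇒sumE≤ : ∀ {g w : Vector n} is → LegalSequence g is → zeroᵛ ≤ᵛ w →
                  Stable L (g -ᵛ (L ·ᵛ w)) → sumE is ≤ᵛ w
    legal⇒sumE≤         []       legal w≥0 stable r = w≥0 r
    legal⇒sumE≤ {g} {w} (i ∷ is) legal w≥0 stable r =
      subst (e i r + sumE is r ≤_) (add-sub (e i r) (w r)) (+-monoʳ-≤ (e i r) (rest≤ r))
      where
      rest≤ : sumE is ≤ᵛ (w -ᵛ e i)
      rest≤ = legal⇒sumE≤ is (legal-tail legal)
                (-ᵛe-nonNeg (unstable⇒fired {g} (legal fzero) w≥0 stable) w≥0)
                (λ s → subst (_< L s s) (sym (firing-split g w i s)) (stable s))
      add-sub : ∀ (a b : ℤ) → a + (b - a) ≡ b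
      add-sub = solve-∀

lemma4p16 : (n : ℕ) (L : Matrix n) → IsZMatrix L → PositiveDiagonal L →
    (c g : Vector n) (is : List (Fin n)) →
    Stable L c →
    (∀ r → c r ≡ subCols L g is r) →
    (∀ (ℓ : Fin (length is)) →
      L (lookup is ℓ) (lookup is ℓ) ≤ subCols L g (take (toℕ ℓ) is) (lookup is ℓ)) →
    (w : Vector n) → zeroᵛ ≤ᵛ w → Stable L (g -ᵛ (L ·ᵛ w)) →
    sumE is ≤ᵛ w
lemma4p16 _ L Z _ _ _ is _ _ legal _ w≥0 stable = legal⇒sumE≤ L Z is legal w≥0 stable
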